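{- Let $n,k\ge1$. A $k$-Skolem sequence of length $n$ exists if and only if $nK_2$ admits a $k$-super graceful labeling whose edge-label set is $[k,k+n-1]$.
   Context: For integers $a\le b$, $[a,b]$ is the set of integers between $a$ and $b$ inclusive. For $n,k\ge 1$, a $k$-Skolem sequence of length $n$ is a sequence of pairs $\{(a_i,b_i)\}_{i=1}^n$ such that the $2n$ numbers $a_1,b_1,\dots,a_n,b_n$ are mutually distinct elements of $[1,2n]$ and $a_i-b_i=k+i-1$ for each $i$. $nK_2$ denotes the disjoint union of $n$ copies of $K_2$. A $k$-super graceful labeling of a graph $G=(V,E)$ with $p$ vertices and $q$ edges is a bijection $f:V\cup E\to[k,k+p+q-1]$ with $f(uv)=|f(u)-f(v)|$ for every edge $uv$. -}

module Defs where

open import Data.Nat using (ℕ; zero; suc; _+_; _∸_; _≤_; ∣_-_∣)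
open import Data.Fin using (Fin; toℕ; _↑ˡ_; _↑ʳ_)
open import Data.Sum using (_⊎_; inj₁; inj₂)
open import Data.Product using (_×_; Σ; ∃; _,_)
open import Relation.Binary.PropositionalEquality using (_≡_; _≢_)

_∈[_,_] : ℕ → ℕ → ℕ → Set
m ∈[ a , b ] = (a ≤ m) × (m ≤ b)

ImageIs : {A : Set} → (A → ℕ) → ℕ → ℕ → Set
ImageIs {A} g a b = ((x : A) → g x ∈[ a , b ]) × ((m : ℕ) → m ∈[ a , b ] → Σ A λ x → g x ≡ m)

-- k-Skolem sequence of length n: pairs (a_i,b_i), i = 1..n (index i ↦ Fin n element with toℕ = i-1)
record SkolemSeq (k n : ℕ) : Set where
  field
    a b      : Fin n → ℕ
    a-range  : (i : Fin n) → a i ∈[ 1 , n + n ]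
    b-range  : (i : Fin n) → b i ∈[ 1 , n + n ]
    a-inj    : (i j : Fin n) → a i ≡ a j → i ≡ j
    b-inj    : (i j : Fin n) → b i ≡ b j → i ≡ j
    ab-disj  : (i j : Fin n) → a i ≢ b j
    -- a_i - b_i = k + i - 1 (with i = toℕ i + 1)
    diff     : (i : Fin n) → a i ≡ b i + (k + toℕ i)

record Graph (p q : ℕ) : Set where
  field
    ends : Fin q → Fin p × Fin p

open Graph

endpoint₁ endpoint₂ : ∀ {p q} → Graph p q → Fin q → Fin p
endpoint₁ G e with ends G e
... | u , _ = u
endpoint₂ G e with ends G e
... | _ , v = v

-- n K_2: vertices Fin (n + n), edge i joins vertex i and vertex n + i
nK₂ : (n : ℕ) → Graph (n + n) n
nK₂ n = record { ends = λ i → (i ↑ˡ n) , (n ↑ʳ i) }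

record SuperGraceful (k : ℕ) {p q : ℕ} (G : Graph p q) : Set where
  field
    f       : Fin p ⊎ Fin q → ℕ
    f-inj   : (x y : Fin p ⊎ Fin q) → f x ≡ f y → x ≡ y
    f-onto  : ImageIs f k (k + p + q ∸ 1)
    f-edge  : (e : Fin q) → f (inj₂ e) ≡ ∣ f (inj₁ (endpoint₁ G e)) - f (inj₁ (endpoint₂ G e)) ∣

EdgeLabelsAre : ∀ {k p q} {G : Graph p q} → SuperGraceful k G → ℕ → ℕ → Set
EdgeLabelsAre {q = q} L a b = ImageIs {Fin q} (λ e → SuperGraceful.f L (inj₂ e)) a b

module Submission where

-- Write K = k + n - 1.  A k-Skolem sequence (a_i , b_i) is the same thing as
-- a labeling of n K₂ in which edge i carries k + i - 1 and its endpoints carry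
-- a_i + K and b_i + K:
--   * edge labels then fill [k , K] and vertex labels fill [K + 1 , K + 2n],
--     together exactly [k , k + 3n - 1], and |(a_i + K) - (b_i + K)| = k + i - 1;
--   * conversely, if the edge labels fill [k , K], injectivity forces every
--     vertex label above K; for the edge labelled k + i - 1 put a_i / b_i for
--     its larger / smaller endpoint label minus K.

open import Defs
open import Data.Nat using (ℕ; suc; _≤_; _<_; _+_; _∸_; ∣_-_∣; s≤s; s≤s⁻¹; z<s; _≤?_)
open import Data.Nat.Properties
open import Data.Nat.Tactic.RingSolver using (solve-∀)
open import Data.Fin using (Fin; toℕ; fromℕ<; splitAt; join; punchOut; _↑ˡ_; _↑ʳ_)
open import Data.Fin.Properties using (toℕ-injective; toℕ<n; toℕ-fromℕ<; join-splitAt; splitAt-↑ˡ; splitAt-↑ʳ; <⇒notInjective; punchOut-injective; any?)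
  renaming (_≟_ to _≟ᶠ_)
open import Data.Product using (Σ; _,_; proj₁; proj₂)
open import Data.Sum using (_⊎_; inj₁; inj₂; [_,_]′)
open import Data.Sum.Properties using (inj₁-injective)
open import Function using (id)
open import Function.Definitions using (Injective)
open import Function.Bundles using (_⇔_; mk⇔)
open import Relation.Nullary using (yes; no; contradiction)
open import Data.Empty using (⊥-elim)
open import Relation.Binary.PropositionalEquality using (_≡_; _≢_; refl; sym; trans; cong; subst)

IsInjective : {A B : Set} → (A → B) → Set
IsInjective g = ∀ x y → g x ≡ g y → x ≡ y

fin-injective⇒surjective : ∀ {N} (g : Fin N → Fin N) → IsInjective g →
  ∀ y → Σ (Fin N) λ x → g x ≡ y
fin-injective⇒surjective g g-inj y with any? (λ x → g x ≟ᶠ y)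
... | yes hit = hit
fin-injective⇒surjective {suc M} g g-inj y | no miss =
  ⊥-elim (<⇒notInjective (n<1+n M) squeezed-injective)
  where
  -- if y is missed, g lands in Fin (suc M) minus y, a copy of Fin M
  avoid : ∀ x → y ≢ g x
  avoid x y≡gx = miss (x , sym y≡gx)

  squeezed-injective : Injective _≡_ _≡_ (λ x → punchOut (avoid x))
  squeezed-injective {x} {x′} eq = g-inj x x′ (punchOut-injective (avoid x) (avoid x′) eq)

-- An injective map Fin M → [1 , M] hits every point of [1 , M]: subtracting
-- one turns it into an injective endomap of Fin M.
injective-fills-interval : ∀ {M} (g : Fin M → ℕ) → (∀ x → g x ∈[ 1 , M ]) →
  IsInjective g → ImageIs g 1 M
injective-fills-interval {M} g range g-inj = range , onto
  where
  pred< : ∀ {m} → m ∈[ 1 , M ] → m ∸ 1 < M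
  pred< {suc m} (_ , m<M) = m<M

  g′ : Fin M → Fin M
  g′ x = fromℕ< (pred< (range x))

  toℕ-g′ : ∀ x → toℕ (g′ x) ≡ g x ∸ 1
  toℕ-g′ x = toℕ-fromℕ< (pred< (range x))

  cancel : ∀ {m m′} → m ∈[ 1 , M ] → m′ ∈[ 1 , M ] → m ∸ 1 ≡ m′ ∸ 1 → m ≡ m′
  cancel (1≤m , _) (1≤m′ , _) = ∸-cancelʳ-≡ 1≤m 1≤m′

  g′-inj : IsInjective g′
  g′-inj x y eq = g-inj x y (cancel (range x) (range y)
    (trans (sym (toℕ-g′ x)) (trans (cong toℕ eq) (toℕ-g′ y))))

  onto : ∀ m → m ∈[ 1 , M ] → Σ (Fin M) λ x → g x ≡ m
  onto m m∈ with fin-injective⇒surjective g′ g′-inj (fromℕ< (pred< m∈))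
  ... | x , hit = x , cancel (range x) m∈
    (trans (sym (toℕ-g′ x)) (trans (cong toℕ hit) (toℕ-fromℕ< (pred< m∈))))

∸-∈ : ∀ {x a b} s → x ∈[ a + s , b + s ] → (x ∸ s) ∈[ a , b ]
∸-∈ {a = a} {b} s (lo , hi) =
  ≤-trans (≤-reflexive (sym (m+n∸n≡m a s))) (∸-monoˡ-≤ s lo) ,
  ≤-trans (∸-monoˡ-≤ s hi) (≤-reflexive (m+n∸n≡m b s))

shift-image : ∀ {A : Set} {g : A → ℕ} {a b} s → ImageIs g a b →
  ImageIs (λ x → g x + s) (a + s) (b + s)
shift-image {g = g} {a} s (range , onto) = shifted-range , shifted-onto
  where
  shifted-range : ∀ x → (g x + s) ∈[ _ , _ ]
  shifted-range x = +-monoˡ-≤ s (proj₁ (range x)) , +-monoˡ-≤ s (proj₂ (range x))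

  shifted-onto : ∀ m → m ∈[ _ , _ ] → Σ _ λ x → g x + s ≡ m
  shifted-onto m m∈ with onto (m ∸ s) (∸-∈ s m∈)
  ... | x , gx≡m∸s = x , trans (cong (_+ s) gx≡m∸s) (m∸n+n≡m (≤-trans (m≤n+m s a) (proj₁ m∈)))

offset-image : ∀ k n → ImageIs (λ (i : Fin (suc n)) → k + toℕ i) k (k + n)
offset-image k n = range , onto
  where
  range : ∀ i → (k + toℕ i) ∈[ k , k + n ]
  range i = m≤m+n k (toℕ i) , +-monoʳ-≤ k (s≤s⁻¹ (toℕ<n i))

  onto : ∀ m → m ∈[ k , k + n ] → Σ (Fin (suc n)) λ i → k + toℕ i ≡ m
  onto m (lo , hi) = fromℕ< m∸k< , trans (cong (k +_) (toℕ-fromℕ< m∸k<)) (m+[n∸m]≡n lo)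
    where
    m∸k< : m ∸ k < suc n
    m∸k< = s≤s (≤-trans (∸-monoˡ-≤ k hi) (≤-reflexive (m+n∸m≡n k n)))

[,]-injective : ∀ {A B C : Set} {g : A → C} {h : B → C} → IsInjective g → IsInjective h →
  (∀ x y → g x ≢ h y) → IsInjective [ g , h ]′
[,]-injective g-inj h-inj disj (inj₁ x) (inj₁ y) eq = cong inj₁ (g-inj x y eq)
[,]-injective g-inj h-inj disj (inj₁ x) (inj₂ y) eq = contradiction eq (disj x y)
[,]-injective g-inj h-inj disj (inj₂ x) (inj₁ y) eq = contradiction (sym eq) (disj y x)
[,]-injective g-inj h-inj disj (inj₂ x) (inj₂ y) eq = cong inj₂ (h-inj x y eq)

adjacent-images-disjoint : ∀ {A B : Set} {g : A → ℕ} {h : B → ℕ} {a m b} →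
  ImageIs g (suc m) b → ImageIs h a m → ∀ x y → g x ≢ h y
adjacent-images-disjoint (g-range , _) (h-range , _) x y =
  >⇒≢ (≤-trans (s≤s (proj₂ (h-range y))) (proj₁ (g-range x)))

adjacent-images-glue : ∀ {A B : Set} {g : A → ℕ} {h : B → ℕ} {a m b} →
  ImageIs g (suc m) b → ImageIs h a m → a ≤ suc m → m ≤ b → ImageIs [ g , h ]′ a b
adjacent-images-glue {m = m} (g-range , g-onto) (h-range , h-onto) a≤1+m m≤b = range , onto
  where
  range : ∀ x → [ _ , _ ]′ x ∈[ _ , _ ]
  range (inj₁ x) = ≤-trans a≤1+m (proj₁ (g-range x)) , proj₂ (g-range x)
  range (inj₂ y) = proj₁ (h-range y) , ≤-trans (proj₂ (h-range y)) m≤b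

  onto : ∀ n → n ∈[ _ , _ ] → Σ _ λ x → [ _ , _ ]′ x ≡ n
  onto n (lo , hi) with n ≤? m
  ... | yes n≤m = let (y , hy) = h-onto n (lo , n≤m) in inj₂ y , hy
  ... | no  n≰m = let (x , gx) = g-onto n (≰⇒> n≰m , hi) in inj₁ x , gx

splitAt-injective : ∀ m {n} → IsInjective (splitAt m {n})
splitAt-injective m {n} v w eq =
  trans (sym (join-splitAt m n v)) (trans (cong (join m n) eq) (join-splitAt m n w))

∣-∣-gap : ∀ {x y d} → ∣ x - y ∣ ≡ d → (x ≡ y + d) ⊎ (y ≡ x + d)
∣-∣-gap {x} {y} refl with ≤-total y x
... | inj₁ y≤x = inj₁ (trans (sym (m+[n∸m]≡n y≤x)) (cong (y +_) (sym (m≤n⇒∣n-m∣≡n∸m y≤x))))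
... | inj₂ x≤y = inj₂ (trans (sym (m+[n∸m]≡n x≤y)) (cong (x +_) (sym (m≤n⇒∣m-n∣≡n∸m x≤y))))

distance-after-shift : ∀ y d K → ∣ y + d + K - y + K ∣ ≡ d
distance-after-shift y d K = trans (cong (λ z → ∣ z - y + K ∣) (shuffle y d K))
  (trans (∣-∣-comm (y + K + d) (y + K)) (∣m-m+n∣≡n (y + K) d))
  where
  shuffle : ∀ y d K → y + d + K ≡ y + K + d
  shuffle = solve-∀

-- Arithmetic of the label intervals, for k = k′ + 1 and n = n′ + 1 (so that
-- K = k + n - 1 = k′ + n and the largest label k + 3n - 1 = k′ + 2n + n).

edge-label-image : ∀ k′ n′ → ImageIs (λ (i : Fin (suc n′)) → suc k′ + toℕ i) (suc k′) (k′ + suc n′)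
edge-label-image k′ n′ = subst (ImageIs _ (suc k′)) (sym (+-suc k′ n′)) (offset-image (suc k′) n′)

largest-label : ∀ k′ N → N + N + (k′ + N) ≡ k′ + (N + N) + N
largest-label = solve-∀

module SkolemToLabeling (k′ n′ : ℕ) (S : SkolemSeq (suc k′) (suc n′)) where
  open SkolemSeq S
  N K : ℕ
  N = suc n′
  K = k′ + N

  position : Fin (N + N) → ℕ
  position v = [ a , b ]′ (splitAt N v)

  position-injective : IsInjective position
  position-injective v w eq = splitAt-injective N v w
    ([,]-injective a-inj b-inj ab-disj (splitAt N v) (splitAt N w) eq)

  position-range : ∀ v → position v ∈[ 1 , N + N ]
  position-range v with splitAt N v
  ... | inj₁ i = a-range i
  ... | inj₂ i = b-range i

  vertex-label : Fin (N + N) → ℕ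
  vertex-label v = position v + K

  edge-label : Fin N → ℕ
  edge-label i = suc k′ + toℕ i

  vertex-label-image : ImageIs vertex-label (suc K) (N + N + K)
  vertex-label-image =
    shift-image K (injective-fills-interval position position-range position-injective)

  label : Fin (N + N) ⊎ Fin N → ℕ
  label = [ vertex-label , edge-label ]′

  label-injective : IsInjective label
  label-injective = [,]-injective
    (λ v w eq → position-injective v w (+-cancelʳ-≡ K _ _ eq))
    (λ i j eq → toℕ-injective (+-cancelˡ-≡ (suc k′) _ _ eq))
    (adjacent-images-disjoint vertex-label-image (edge-label-image k′ n′))

  label-image : ImageIs label (suc k′) (k′ + (N + N) + N)
  label-image = subst (ImageIs label (suc k′)) (largest-label k′ N)
    (adjacent-images-glue vertex-label-image (edge-label-image k′ n′)
      (s≤s (m≤m+n k′ N)) (m≤n+m K (N + N)))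

  -- edge i joins labels b_i + K + (k + i) and b_i + K
  label-edge : ∀ e → label (inj₂ e) ≡
    ∣ label (inj₁ (endpoint₁ (nK₂ N) e)) - label (inj₁ (endpoint₂ (nK₂ N) e)) ∣
  label-edge e rewrite splitAt-↑ˡ N e N | splitAt-↑ʳ N N e | diff e =
    sym (distance-after-shift (b e) (suc k′ + toℕ e) K)

  labeling : SuperGraceful (suc k′) (nK₂ N)
  labeling = record { f = label ; f-inj = label-injective ; f-onto = label-image ; f-edge = label-edge }

  edge-labels : EdgeLabelsAre labeling (suc k′) K
  edge-labels = edge-label-image k′ n′

module LabelingToSkolem (k′ n′ : ℕ) (L : SuperGraceful (suc k′) (nK₂ (suc n′)))
                        (edges : EdgeLabelsAre L (suc k′) (k′ + suc n′)) where
  open SuperGraceful L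
  N K : ℕ
  N = suc n′
  K = k′ + N

  vertex-label : Fin (N + N) → ℕ
  vertex-label v = f (inj₁ v)

  -- the edge labels already use up [k , K], so vertex labels lie above K
  vertex-label-above : ∀ v → K < vertex-label v
  vertex-label-above v with vertex-label v ≤? K
  ... | no  ≰K = ≰⇒> ≰K
  ... | yes ≤K with proj₂ edges (vertex-label v) (proj₁ (proj₁ f-onto (inj₁ v)) , ≤K)
  ... | e , same with f-inj (inj₂ e) (inj₁ v) same
  ... | ()

  position : Fin (N + N) → ℕ
  position v = vertex-label v ∸ K

  position-range : ∀ v → position v ∈[ 1 , N + N ]
  position-range v = ∸-∈ K (vertex-label-above v ,
    subst (vertex-label v ≤_) (sym (largest-label k′ N)) (proj₂ (proj₁ f-onto (inj₁ v))))

  position-injective : IsInjective position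
  position-injective v w eq = inj₁-injective (f-inj (inj₁ v) (inj₁ w)
    (∸-cancelʳ-≡ (<⇒≤ (vertex-label-above v)) (<⇒≤ (vertex-label-above w)) eq))

  edge-of : Fin (N + N) → Fin N
  edge-of v = [ id , id ]′ (splitAt N v)

  edge-of-left : ∀ e → edge-of (e ↑ˡ N) ≡ e
  edge-of-left e rewrite splitAt-↑ˡ N e N = refl

  edge-of-right : ∀ e → edge-of (N ↑ʳ e) ≡ e
  edge-of-right e rewrite splitAt-↑ʳ N N e = refl

  record Orientation (e : Fin N) : Set where
    field
      high low : Fin (N + N)
      high-on  : edge-of high ≡ e
      low-on   : edge-of low ≡ e
      gap      : vertex-label high ≡ vertex-label low + f (inj₂ e)

  orient : ∀ e → Orientation e
  orient e with ∣-∣-gap (sym (f-edge e))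
  ... | inj₁ left-high = record { high = e ↑ˡ N ; low = N ↑ʳ e
    ; high-on = edge-of-left e ; low-on = edge-of-right e ; gap = left-high }
  ... | inj₂ right-high = record { high = N ↑ʳ e ; low = e ↑ˡ N
    ; high-on = edge-of-right e ; low-on = edge-of-left e ; gap = right-high }

  labelled : Fin N → Fin N
  labelled i = proj₁ (proj₂ edges (suc k′ + toℕ i) (proj₁ (edge-label-image k′ n′) i))

  labelled-label : ∀ i → f (inj₂ (labelled i)) ≡ suc k′ + toℕ i
  labelled-label i = proj₂ (proj₂ edges (suc k′ + toℕ i) (proj₁ (edge-label-image k′ n′) i))

  labelled-injective : IsInjective labelled
  labelled-injective i j eq = toℕ-injective (+-cancelˡ-≡ (suc k′) _ _
    (trans (sym (labelled-label i)) (trans (cong (λ e → f (inj₂ e)) eq) (labelled-label j))))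

  -- a vertex lies on only one edge, so it determines the pair index
  same-edge : ∀ {v w} i j → edge-of v ≡ labelled i → edge-of w ≡ labelled j → v ≡ w → i ≡ j
  same-edge i j on-i on-j refl = labelled-injective i j (trans (sym on-i) on-j)

  module O (i : Fin N) = Orientation (orient (labelled i))

  high-label : ∀ i → vertex-label (O.high i) ≡ vertex-label (O.low i) + (suc k′ + toℕ i)
  high-label i = trans (O.gap i) (cong (vertex-label (O.low i) +_) (labelled-label i))

  A B : Fin N → ℕ
  A i = position (O.high i)
  B i = position (O.low i)

  -- the endpoints of an edge carry different labels, as its label is positive
  endpoints-differ : ∀ i → O.high i ≢ O.low i
  endpoints-differ i high≡low = <⇒≢ (m<m+n (vertex-label (O.low i)) z<s)
    (trans (cong vertex-label (sym high≡low)) (high-label i))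

  A-B-disjoint : ∀ i j → A i ≢ B j
  A-B-disjoint i j eq with position-injective _ _ eq
  ... | high≡low with same-edge i j (O.high-on i) (O.low-on j) high≡low
  ... | refl = endpoints-differ i high≡low

  A-difference : ∀ i → A i ≡ B i + (suc k′ + toℕ i)
  A-difference i = trans (cong (_∸ K) (high-label i))
    (+-∸-comm (suc k′ + toℕ i) (<⇒≤ (vertex-label-above (O.low i))))

  skolem : SkolemSeq (suc k′) N
  skolem = record
    { a = A ; b = B
    ; a-range = λ i → position-range (O.high i)
    ; b-range = λ i → position-range (O.low i)
    ; a-inj = λ i j eq → same-edge i j (O.high-on i) (O.high-on j) (position-injective _ _ eq)
    ; b-inj = λ i j eq → same-edge i j (O.low-on i) (O.low-on j) (position-injective _ _ eq)
    ; ab-disj = A-B-disjoint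
    ; diff = A-difference
    }

lemma3p10 : (n k : ℕ) → 1 ≤ n → 1 ≤ k →
    SkolemSeq k n ⇔ Σ (SuperGraceful k (nK₂ n)) (λ L → EdgeLabelsAre L k (k + n ∸ 1))
lemma3p10 (suc n′) (suc k′) _ _ = mk⇔
  (λ S → SkolemToLabeling.labeling k′ n′ S , SkolemToLabeling.edge-labels k′ n′ S)
  (λ (L , edges) → LabelingToSkolem.skolem k′ n′ L edges)
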